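{- For any graph $G$, $$\sum_{S \in \mathcal{D}(G)} |N_1(S)| = \sum_{e \in E(G)} |\mathcal{D}(G) - \mathcal{D}(G-e)|.$$
   Context: Graphs are finite and simple with vertex set $V$. $N[v]$ is the closed neighbourhood of $v$. A set $S \subseteq V$ is dominating if every vertex is in $S$ or adjacent to a vertex of $S$; $\mathcal{D}(G)$ is the collection of dominating sets of $G$, and $G - e$ is $G$ with edge $e$ deleted (same vertex set). For $S \in \mathcal{D}(G)$, $N_1(S) = \{v \in V - S : |N[v] \cap S| = 1\}$. -}

module Defs where

open import Data.Bool using (Bool; true; false; _∧_; _∨_; not; if_then_else_)
open import Data.Nat using (ℕ; zero; suc; _+_; _<ᵇ_; _≡ᵇ_)
open import Data.Fin using (Fin; toℕ; _≟_)
open import Data.Fin.Subset using (Subset)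
open import Data.List using (List; []; _∷_; map; length; filterᵇ; allFin; concatMap)
open import Data.Bool.ListAction using (all; any)
open import Data.Vec using (Vec; lookup) renaming ([] to []ᵥ; _∷_ to _∷ᵥ_)
open import Data.Product using (_×_; _,_)
open import Relation.Binary.PropositionalEquality using (_≡_)
open import Relation.Nullary.Decidable using (⌊_⌋)

record Graph (n : ℕ) : Set where
  field
    adj    : Fin n → Fin n → Bool
    sym    : ∀ u v → adj u v ≡ adj v u
    irrefl : ∀ v → adj v v ≡ false
open Graph public

Adj : ℕ → Set
Adj n = Fin n → Fin n → Bool

inClosedNbr : ∀ {n} → Adj n → Fin n → Fin n → Bool
inClosedNbr A v u = ⌊ u ≟ v ⌋ ∨ A v u

mem : ∀ {n} → Subset n → Fin n → Bool
mem S u = lookup S u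

nbrCount : ∀ {n} → Adj n → Subset n → Fin n → ℕ
nbrCount A S v = length (filterᵇ (λ u → mem S u ∧ inClosedNbr A v u) (allFin _))

isDominating : ∀ {n} → Adj n → Subset n → Bool
isDominating A S = all (λ v → mem S v ∨ any (λ u → mem S u ∧ A v u) (allFin _)) (allFin _)

allSubsets : (n : ℕ) → List (Subset n)
allSubsets zero = []ᵥ ∷ []
allSubsets (suc n) = concatMap (λ S → (false ∷ᵥ S) ∷ (true ∷ᵥ S) ∷ []) (allSubsets n)

domSets : ∀ {n} → Adj n → List (Subset n)
domSets {n} A = filterᵇ (isDominating A) (allSubsets n)

N₁size : ∀ {n} → Adj n → Subset n → ℕ
N₁size A S = length (filterᵇ (λ v → not (mem S v) ∧ (nbrCount A S v ≡ᵇ 1)) (allFin _))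

edges : ∀ {n} → Adj n → List (Fin n × Fin n)
edges {n} A = concatMap (λ i → map (λ j → (i , j))
                 (filterᵇ (λ j → (toℕ i <ᵇ toℕ j) ∧ A i j) (allFin n))) (allFin n)

deleteEdge : ∀ {n} → Adj n → Fin n × Fin n → Adj n
deleteEdge A (i , j) u v =
  A u v ∧ not ((⌊ u ≟ i ⌋ ∧ ⌊ v ≟ j ⌋) ∨ (⌊ u ≟ j ⌋ ∧ ⌊ v ≟ i ⌋))

lostDomSets : ∀ {n} → Adj n → Fin n × Fin n → ℕ
lostDomSets A e =
  length (filterᵇ (λ S → isDominating A S ∧ not (isDominating (deleteEdge A e) S)) (allSubsets _))

-- Double counting of dominating sets that are destroyed by deleting an edge.
--
-- Fix a dominating set S of G and an edge ij.  Deleting ij only changes the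
-- neighbourhoods of i and j, so S fails to dominate G - ij exactly when one
-- endpoint, say j, loses its last S-dominator: j ∉ S, i ∈ S and |N[j] ∩ S| = 1,
-- i.e. j ∈ N₁(S) and i is its unique S-neighbour ("the arc j → i is
-- critical").  These two situations are mutually exclusive, so summing over
-- the edges counts every arc v → u with u ∈ S adjacent to v ∈ N₁(S); each
-- v ∈ N₁(S) has exactly one such arc, giving |N₁(S)| (lemma
-- dominating-set-count).  Summing over all S and exchanging the two finite
-- sums yields the theorem.
module Submission where

open import Defs hiding (sym)
open import Data.Bool using (Bool; true; false; _∧_; _∨_; not; if_then_else_; T)
open import Data.Bool.Properties
  using (∧-zeroʳ; ∧-identityʳ; ∨-identityʳ; ∨-comm; ∧-conicalʳ; T-∧; T-≡; T-not-≡)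
open import Data.Bool.ListAction using (all; any; or)
open import Data.Nat using (ℕ; zero; suc; _+_; _<ᵇ_; _≡ᵇ_)
open import Data.Nat.Properties
  using (+-identityʳ; +-*-semiring; +-commutativeSemigroup; ≡ᵇ⇒≡)
open import Data.Nat.ListAction using (sum)
open import Data.Nat.ListAction.Properties using (sum-++)
open import Data.Fin using (Fin; toℕ; _≟_) renaming (zero to fzero; suc to fsuc)
open import Data.Fin.Properties using (toℕ-injective)
open import Data.Fin.Subset using (Subset)
open import Data.List using (List; []; _∷_; _++_; map; length; filterᵇ; allFin; concatMap; tabulate)
open import Data.List.Properties using (map-cong; map-++; map-∘)
open import Data.List.Relation.Unary.All.Properties using (all⁺; all⁻; tabulate⁺; tabulate⁻)
open import Data.Product using (_×_; _,_)
open import Data.Empty using (⊥-elim)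
open import Function using (_∘_; _⇔_; mk⇔; Equivalence)
open import Relation.Binary.PropositionalEquality
open import Relation.Nullary using (yes; no)
open import Relation.Nullary.Decidable using (⌊_⌋; dec-true; dec-false; isYes≗does)
open import Algebra.Properties.Semiring.Sum +-*-semiring
  using (sum-syntax; ∑-distrib-+; ∑-comm; sum-cong-≗; sum-replicate-zero)
  renaming (sum to ∑)
open import Algebra.Properties.CommutativeSemigroup +-commutativeSemigroup using (interchange)

open Equivalence using (to; from)

ind : Bool → ℕ
ind true  = 1
ind false = 0

-- The indicator of a disjoint union is the sum of the indicators; stated in
-- the form "not (not x ∧ not y)" in which a destroyed domination appears.
ind-lost : ∀ x y → x ∧ y ≡ false → ind (not (not x ∧ not y)) ≡ ind x + ind y
ind-lost true  true  ()
ind-lost true  false _ = refl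
ind-lost false true  _ = refl
ind-lost false false _ = refl

ind-split : ∀ d x y → ind (x ∧ y) ≡ ind (d ∧ (x ∧ y)) + ind (x ∧ (y ∧ not d))
ind-split true  x y rewrite ∧-zeroʳ y | ∧-zeroʳ x = sym (+-identityʳ _)
ind-split false x y rewrite ∧-identityʳ y = refl

if-cong : ∀ b {x y : ℕ} → (b ≡ true → x ≡ y) → (if b then x else 0) ≡ (if b then y else 0)
if-cong true  h = h refl
if-cong false h = refl

if-+ : ∀ b x y → (if b then x + y else 0) ≡ (if b then x else 0) + (if b then y else 0)
if-+ true  x y = refl
if-+ false x y = refl

if-ind : ∀ b x → (if b then ind x else 0) ≡ ind (x ∧ b)
if-ind true  x = cong ind (sym (∧-identityʳ x))
if-ind false x = cong ind (sym (∧-zeroʳ x))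

T-ext : ∀ {x y} → (T x → T y) → (T y → T x) → x ≡ y
T-ext {false} {false} _ _ = refl
T-ext {false} {true}  _ g = ⊥-elim (g _)
T-ext {true}  {false} f _ = ⊥-elim (f _)
T-ext {true}  {true}  _ _ = refl

sum-map-cong : ∀ {A : Set} {f g : A → ℕ} (xs : List A) →
  (∀ x → f x ≡ g x) → sum (map f xs) ≡ sum (map g xs)
sum-map-cong xs h = cong sum (map-cong h xs)

sum-map-zero : ∀ {A : Set} (xs : List A) → sum (map (λ _ → 0) xs) ≡ 0
sum-map-zero []       = refl
sum-map-zero (x ∷ xs) = sum-map-zero xs

sum-map-+ : ∀ {A : Set} (f g : A → ℕ) (xs : List A) →
  sum (map (λ x → f x + g x) xs) ≡ sum (map f xs) + sum (map g xs)
sum-map-+ f g []       = refl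
sum-map-+ f g (x ∷ xs) =
  trans (cong (f x + g x +_) (sum-map-+ f g xs)) (interchange (f x) (g x) _ _)

sum-map-comm : ∀ {A B : Set} (h : A → B → ℕ) (xs : List A) (ys : List B) →
  sum (map (λ x → sum (map (h x) ys)) xs) ≡ sum (map (λ y → sum (map (λ x → h x y) xs)) ys)
sum-map-comm h []       ys = sym (sum-map-zero ys)
sum-map-comm h (x ∷ xs) ys =
  trans (cong (sum (map (h x) ys) +_) (sum-map-comm h xs ys))
        (sym (sum-map-+ (h x) (λ y → sum (map (λ x′ → h x′ y) xs)) ys))

length-filterᵇ : ∀ {A : Set} (p : A → Bool) (xs : List A) →
  length (filterᵇ p xs) ≡ sum (map (ind ∘ p) xs)
length-filterᵇ p []       = refl
length-filterᵇ p (x ∷ xs) with p x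
... | true  = cong suc (length-filterᵇ p xs)
... | false = length-filterᵇ p xs

sum-map-filterᵇ : ∀ {A : Set} (p : A → Bool) (f : A → ℕ) (xs : List A) →
  sum (map f (filterᵇ p xs)) ≡ sum (map (λ x → if p x then f x else 0) xs)
sum-map-filterᵇ p f []       = refl
sum-map-filterᵇ p f (x ∷ xs) with p x
... | true  = cong (f x +_) (sum-map-filterᵇ p f xs)
... | false = sum-map-filterᵇ p f xs

sum-map-concatMap : ∀ {A B : Set} (h : A → List B) (f : B → ℕ) (xs : List A) →
  sum (map f (concatMap h xs)) ≡ sum (map (λ x → sum (map f (h x))) xs)
sum-map-concatMap h f []       = refl
sum-map-concatMap h f (x ∷ xs) = begin
  sum (map f (h x ++ concatMap h xs))
    ≡⟨ cong sum (map-++ f (h x) (concatMap h xs)) ⟩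
  sum (map f (h x) ++ map f (concatMap h xs))
    ≡⟨ sum-++ (map f (h x)) _ ⟩
  sum (map f (h x)) + sum (map f (concatMap h xs))
    ≡⟨ cong (sum (map f (h x)) +_) (sum-map-concatMap h f xs) ⟩
  sum (map f (h x)) + sum (map (λ x′ → sum (map f (h x′))) xs) ∎
  where open ≡-Reasoning

any-count : ∀ {A : Set} (p : A → Bool) (xs : List A) →
  any p xs ≡ not (length (filterᵇ p xs) ≡ᵇ 0)
any-count p []       = refl
any-count p (x ∷ xs) with p x
... | true  = refl
... | false = any-count p xs

sum-map-tabulate : ∀ {n} {A : Set} (f : A → ℕ) (g : Fin n → A) →
  sum (map f (tabulate g)) ≡ ∑[ k < n ] f (g k)
sum-map-tabulate {zero}  f g = refl
sum-map-tabulate {suc n} f g = cong (f (g fzero) +_) (sum-map-tabulate f (g ∘ fsuc))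

count-allFin : ∀ {n} (p : Fin n → Bool) → length (filterᵇ p (allFin n)) ≡ ∑[ u < n ] ind (p u)
count-allFin p = trans (length-filterᵇ p (allFin _)) (sum-map-tabulate (ind ∘ p) (λ u → u))

∑∑-cong : ∀ {m n} {f g : Fin m → Fin n → ℕ} → (∀ i j → f i j ≡ g i j) →
  ∑[ i < m ] ∑[ j < n ] f i j ≡ ∑[ i < m ] ∑[ j < n ] g i j
∑∑-cong h = sum-cong-≗ (λ i → sum-cong-≗ (h i))

∑∑-distrib-+ : ∀ {m n} (f g : Fin m → Fin n → ℕ) →
  ∑[ i < m ] ∑[ j < n ] (f i j + g i j) ≡ ∑[ i < m ] ∑[ j < n ] f i j + ∑[ i < m ] ∑[ j < n ] g i j
∑∑-distrib-+ f g = trans (sum-cong-≗ (λ i → ∑-distrib-+ (f i) (g i)))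
                         (∑-distrib-+ (λ i → ∑ (f i)) (λ i → ∑ (g i)))

-- ⌊_⌋ (isYes) does not compute through the recursion of Fin's _≟_; these
-- three facts are the computation rules the proof needs.
⌊≟⌋-true : ∀ {n} {a b : Fin n} → a ≡ b → ⌊ a ≟ b ⌋ ≡ true
⌊≟⌋-true {a = a} {b} a≡b = trans (isYes≗does (a ≟ b)) (dec-true (a ≟ b) a≡b)

⌊≟⌋-false : ∀ {n} {a b : Fin n} → a ≢ b → ⌊ a ≟ b ⌋ ≡ false
⌊≟⌋-false {a = a} {b} a≢b = trans (isYes≗does (a ≟ b)) (dec-false (a ≟ b) a≢b)

≟-suc : ∀ {n} (u w : Fin n) → ⌊ fsuc u ≟ fsuc w ⌋ ≡ ⌊ u ≟ w ⌋
≟-suc u w with u ≟ w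
... | yes _ = refl
... | no _  = refl

∑-δ : ∀ {n} (w : Fin n) (g : Fin n → Bool) → ∑[ u < n ] ind (⌊ u ≟ w ⌋ ∧ g u) ≡ ind (g w)
∑-δ {suc n} fzero    g = trans (cong (ind (g fzero) +_) (sum-replicate-zero n)) (+-identityʳ _)
∑-δ {suc n} (fsuc w) g =
  trans (sum-cong-≗ (λ u → cong (λ b → ind (b ∧ g (fsuc u))) (≟-suc u w))) (∑-δ w (g ∘ fsuc))

all-allFin : ∀ {n} (p : Fin n → Bool) → T (all p (allFin n)) ⇔ (∀ v → T (p v))
all-allFin p = mk⇔ (tabulate⁻ ∘ all⁺ p (allFin _)) (all⁻ p ∘ tabulate⁺)

all-except-pair : ∀ {n} (p : Fin n → Bool) (i j : Fin n) →
  (∀ v → v ≢ i → v ≢ j → p v ≡ true) → all p (allFin n) ≡ p i ∧ p j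
all-except-pair p i j elsewhere = T-ext
  (λ t → from T-∧ (to (all-allFin p) t i , to (all-allFin p) t j))
  (λ t → from (all-allFin p) (everywhere (to T-∧ t)))
  where
  everywhere : T (p i) × T (p j) → ∀ v → T (p v)
  everywhere (pi , pj) v with v ≟ i | v ≟ j
  ... | yes refl | _        = pi
  ... | no _     | yes refl = pj
  ... | no v≢i   | no v≢j   = from T-≡ (elsewhere v v≢i v≢j)

lt : ∀ {n} → Fin n → Fin n → Bool
lt i j = toℕ i <ᵇ toℕ j

<ᵇ-exclusive : ∀ m n → m ≢ n → ind (m <ᵇ n) + ind (n <ᵇ m) ≡ 1
<ᵇ-exclusive zero    zero    m≢n = ⊥-elim (m≢n refl)
<ᵇ-exclusive zero    (suc n) _   = refl
<ᵇ-exclusive (suc m) zero    _   = refl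
<ᵇ-exclusive (suc m) (suc n) m≢n = <ᵇ-exclusive m n (m≢n ∘ cong suc)

if-exactly-one : ∀ l₁ l₂ x → ind l₁ + ind l₂ ≡ 1 →
  (if l₁ then x else 0) + (if l₂ then x else 0) ≡ x
if-exactly-one true  true  x ()
if-exactly-one true  false x _ = +-identityʳ x
if-exactly-one false true  x _ = refl
if-exactly-one false false x ()

order-split : ∀ {n} (a b : Fin n) e x → (e ≡ true → a ≢ b) →
  (if lt a b ∧ e then x else 0) + (if lt b a ∧ e then x else 0) ≡ (if e then x else 0)
order-split a b false x _ rewrite ∧-zeroʳ (lt a b) | ∧-zeroʳ (lt b a) = refl
order-split a b true  x a≢b rewrite ∧-identityʳ (lt a b) | ∧-identityʳ (lt b a) =
  if-exactly-one (lt a b) (lt b a) x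
    (<ᵇ-exclusive (toℕ a) (toℕ b) (a≢b refl ∘ toℕ-injective))

∑-unordered-pairs : ∀ {n} (E : Fin n → Fin n → Bool) →
  (∀ a b → E a b ≡ E b a) → (∀ a → E a a ≡ false) → (f : Fin n → Fin n → ℕ) →
  ∑[ i < n ] ∑[ j < n ] (if lt i j ∧ E i j then f i j + f j i else 0)
    ≡ ∑[ a < n ] ∑[ b < n ] (if E a b then f a b else 0)
∑-unordered-pairs {n} E E-sym E-irrefl f = begin
  ∑[ i < n ] ∑[ j < n ] (if lt i j ∧ E i j then f i j + f j i else 0)
    ≡⟨ ∑∑-cong (λ i j → if-+ (lt i j ∧ E i j) (f i j) (f j i)) ⟩
  ∑[ i < n ] ∑[ j < n ] (forward i j + backward i j)
    ≡⟨ ∑∑-distrib-+ forward backward ⟩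
  ∑[ a < n ] ∑[ b < n ] forward a b + ∑[ i < n ] ∑[ j < n ] backward i j
    ≡⟨ cong (∑[ a < n ] ∑[ b < n ] forward a b +_)
            (trans (∑-comm backward) (∑∑-cong (λ a b →
               cong (λ e → if lt b a ∧ e then f a b else 0) (E-sym b a)))) ⟩
  ∑[ a < n ] ∑[ b < n ] forward a b + ∑[ a < n ] ∑[ b < n ] mirrored a b
    ≡⟨ sym (∑∑-distrib-+ forward mirrored) ⟩
  ∑[ a < n ] ∑[ b < n ] (forward a b + mirrored a b)
    ≡⟨ ∑∑-cong (λ a b → order-split a b (E a b) (f a b) (irreflexive a b)) ⟩
  ∑[ a < n ] ∑[ b < n ] (if E a b then f a b else 0) ∎
  where
  open ≡-Reasoning
  forward backward mirrored : Fin n → Fin n → ℕ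
  forward  i j = if lt i j ∧ E i j then f i j else 0
  backward i j = if lt i j ∧ E i j then f j i else 0
  mirrored a b = if lt b a ∧ E a b then f a b else 0
  irreflexive : ∀ a b → E a b ≡ true → a ≢ b
  irreflexive a .a Eaa refl with () ← trans (sym Eaa) (E-irrefl a)

sum-over-edges : ∀ {n} (A : Adj n) (g : Fin n × Fin n → ℕ) →
  sum (map g (edges A)) ≡ ∑[ i < n ] ∑[ j < n ] (if lt i j ∧ A i j then g (i , j) else 0)
sum-over-edges {n} A g = begin
  sum (map g (edges A))
    ≡⟨ sum-map-concatMap (λ i → map (i ,_) (later i)) g (allFin n) ⟩
  sum (map (λ i → sum (map g (map (i ,_) (later i)))) (allFin n))
    ≡⟨ sum-map-tabulate (λ i → sum (map g (map (i ,_) (later i)))) (λ i → i) ⟩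
  ∑[ i < n ] sum (map g (map (i ,_) (later i)))
    ≡⟨ sum-cong-≗ row ⟩
  ∑[ i < n ] ∑[ j < n ] (if lt i j ∧ A i j then g (i , j) else 0) ∎
  where
  open ≡-Reasoning
  later : Fin n → List (Fin n)
  later i = filterᵇ (λ j → lt i j ∧ A i j) (allFin n)
  row : ∀ i → sum (map g (map (i ,_) (later i)))
            ≡ ∑[ j < n ] (if lt i j ∧ A i j then g (i , j) else 0)
  row i = trans (cong sum (sym (map-∘ (later i))))
         (trans (sum-map-filterᵇ (λ j → lt i j ∧ A i j) (g ∘ (i ,_)) (allFin n))
                (sum-map-tabulate (λ j → if lt i j ∧ A i j then g (i , j) else 0) (λ j → j)))

module _ {n} (A : Adj n) where

  deleteEdge-swap : ∀ i j u v → deleteEdge A (i , j) u v ≡ deleteEdge A (j , i) u v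
  deleteEdge-swap i j u v =
    cong (λ b → A u v ∧ not b) (∨-comm (⌊ u ≟ i ⌋ ∧ ⌊ v ≟ j ⌋) (⌊ u ≟ j ⌋ ∧ ⌊ v ≟ i ⌋))

  deleteEdge-endpoint : ∀ {i j} → i ≢ j → ∀ u → deleteEdge A (i , j) i u ≡ A i u ∧ not ⌊ u ≟ j ⌋
  deleteEdge-endpoint {i} {j} i≢j u
    rewrite ⌊≟⌋-true {a = i} refl | ⌊≟⌋-false i≢j =
      cong (λ b → A i u ∧ not b) (∨-identityʳ _)

  deleteEdge-other : ∀ {i j v} → v ≢ i → v ≢ j → ∀ u → deleteEdge A (i , j) v u ≡ A v u
  deleteEdge-other {i} {j} {v} v≢i v≢j u
    rewrite ⌊≟⌋-false v≢i | ⌊≟⌋-false v≢j = ∧-identityʳ _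

module Domination {n} (A : Adj n) (S : Subset n) where

  dominated : Adj n → Fin n → Bool
  dominated B v = mem S v ∨ any (λ u → mem S u ∧ B v u) (allFin n)

  openCount : Adj n → Fin n → ℕ
  openCount B v = ∑[ u < n ] ind (mem S u ∧ B v u)

  inN₁ : Fin n → Bool
  inN₁ v = not (mem S v) ∧ (nbrCount A S v ≡ᵇ 1)

  -- u ∈ S and v ∈ N₁(S): if u is adjacent to v, it is v's only S-dominator.
  critical : Fin n → Fin n → Bool
  critical u v = mem S u ∧ inN₁ v

  -- The arcs u → v and v → u cannot both be critical: one needs v ∈ S, u ∉ S,
  -- the other u ∈ S, v ∉ S.
  critical-exclusive : ∀ u v → critical u v ∧ critical v u ≡ false
  critical-exclusive u v = exclusive (mem S u) (mem S v) _ _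
    where
    exclusive : ∀ x y p q → (x ∧ (not y ∧ p)) ∧ (y ∧ (not x ∧ q)) ≡ false
    exclusive false y     p q = refl
    exclusive true  true  p q = refl
    exclusive true  false p q = ∧-zeroʳ p

  dominated-cong : ∀ {B B′ v} → (∀ u → B v u ≡ B′ v u) → dominated B v ≡ dominated B′ v
  dominated-cong {v = v} h =
    cong (λ bs → mem S v ∨ or bs) (map-cong (λ u → cong (mem S u ∧_) (h u)) (allFin n))

  any-as-count : ∀ B v → any (λ u → mem S u ∧ B v u) (allFin n) ≡ not (openCount B v ≡ᵇ 0)
  any-as-count B v =
    trans (any-count (λ u → mem S u ∧ B v u) (allFin n))
          (cong (λ k → not (k ≡ᵇ 0)) (count-allFin (λ u → mem S u ∧ B v u)))

  closed-count : ∀ {v} → mem S v ≡ false → nbrCount A S v ≡ openCount A v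
  closed-count {v} v∉S = trans (count-allFin (λ u → mem S u ∧ inClosedNbr A v u)) (sum-cong-≗ drop-v)
    where
    drop-v : ∀ u → ind (mem S u ∧ inClosedNbr A v u) ≡ ind (mem S u ∧ A v u)
    drop-v u with u ≟ v
    ... | yes refl rewrite v∉S = refl
    ... | no _     = refl

  remove-count : ∀ (B : Adj n) v w → (∀ u → B v u ≡ A v u ∧ not ⌊ u ≟ w ⌋) → A v w ≡ true →
    openCount A v ≡ ind (mem S w) + openCount B v
  remove-count B v w row vw = begin
    ∑[ u < n ] ind (mem S u ∧ A v u)
      ≡⟨ sum-cong-≗ (λ u → ind-split ⌊ u ≟ w ⌋ (mem S u) (A v u)) ⟩
    ∑[ u < n ] (ind (⌊ u ≟ w ⌋ ∧ (mem S u ∧ A v u)) + ind (mem S u ∧ (A v u ∧ not ⌊ u ≟ w ⌋)))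
      ≡⟨ ∑-distrib-+ (λ u → ind (⌊ u ≟ w ⌋ ∧ (mem S u ∧ A v u)))
                     (λ u → ind (mem S u ∧ (A v u ∧ not ⌊ u ≟ w ⌋))) ⟩
    ∑[ u < n ] ind (⌊ u ≟ w ⌋ ∧ (mem S u ∧ A v u)) + ∑[ u < n ] ind (mem S u ∧ (A v u ∧ not ⌊ u ≟ w ⌋))
      ≡⟨ cong₂ _+_ (∑-δ w (λ u → mem S u ∧ A v u))
                   (sum-cong-≗ (λ u → cong (λ b → ind (mem S u ∧ b)) (sym (row u)))) ⟩
    ind (mem S w ∧ A v w) + openCount B v
      ≡⟨ cong (λ b → ind b + openCount B v) (trans (cong (mem S w ∧_) vw) (∧-identityʳ _)) ⟩
    ind (mem S w) + openCount B v ∎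
    where open ≡-Reasoning

  -- The arithmetic behind losing one neighbour: sv, sw say whether v, w ∈ S,
  -- cA, cB are |N(v) ∩ S| before and after, m = |N[v] ∩ S| before.
  still-dominated : ∀ sv sw cA cB m → cA ≡ ind sw + cB → (sv ∨ not (cA ≡ᵇ 0)) ≡ true →
    (sv ≡ false → m ≡ cA) → (sv ∨ not (cB ≡ᵇ 0)) ≡ not (sw ∧ (not sv ∧ (m ≡ᵇ 1)))
  still-dominated true  sw    cA cB m _    _   _      = sym (cong not (∧-zeroʳ sw))
  still-dominated false true  cA cB m refl _   closed rewrite closed refl = refl
  still-dominated false false cA cB m refl dom _      = dom

  lose-neighbour : ∀ (B : Adj n) v w → (∀ u → B v u ≡ A v u ∧ not ⌊ u ≟ w ⌋) → A v w ≡ true →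
    dominated A v ≡ true → dominated B v ≡ not (critical w v)
  lose-neighbour B v w row vw dom =
    trans (cong (mem S v ∨_) (any-as-count B v))
      (still-dominated (mem S v) (mem S w) (openCount A v) (openCount B v) (nbrCount A S v)
        (remove-count B v w row vw)
        (trans (cong (mem S v ∨_) (sym (any-as-count A v))) dom)
        closed-count)

  dominated-everywhere : isDominating A S ≡ true → ∀ v → dominated A v ≡ true
  dominated-everywhere domS v = to T-≡ (to (all-allFin (dominated A)) (from T-≡ domS) v)

  edge-deletion : (∀ u v → A u v ≡ A v u) → isDominating A S ≡ true →
    ∀ {i j} → i ≢ j → A i j ≡ true →
    isDominating (deleteEdge A (i , j)) S ≡ not (critical j i) ∧ not (critical i j)
  edge-deletion A-sym domS {i} {j} i≢j ij = begin
    all (dominated A′) (allFin n)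
      ≡⟨ all-except-pair (dominated A′) i j unaffected ⟩
    dominated A′ i ∧ dominated A′ j
      ≡⟨ cong₂ _∧_ (lose-neighbour A′ i j (deleteEdge-endpoint A i≢j) ij (dom i))
                   (lose-neighbour A′ j i row-j (trans (A-sym j i) ij) (dom j)) ⟩
    not (critical j i) ∧ not (critical i j) ∎
    where
    open ≡-Reasoning
    A′ : Adj n
    A′ = deleteEdge A (i , j)
    dom : ∀ v → dominated A v ≡ true
    dom = dominated-everywhere domS
    unaffected : ∀ v → v ≢ i → v ≢ j → dominated A′ v ≡ true
    unaffected v v≢i v≢j = trans (dominated-cong {A′} {A} (deleteEdge-other A v≢i v≢j)) (dom v)
    row-j : ∀ u → A′ j u ≡ A j u ∧ not ⌊ u ≟ i ⌋
    row-j u = trans (deleteEdge-swap A i j j u) (deleteEdge-endpoint A (i≢j ∘ sym) u)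

  unique-dominator : ∀ {v} → inN₁ v ≡ true → openCount A v ≡ 1
  unique-dominator {v} v∈N₁ with to T-∧ (from T-≡ v∈N₁)
  ... | v∉S , single = trans (sym (closed-count (to T-not-≡ v∉S))) (≡ᵇ⇒≡ _ 1 single)

  critical-arcs-at : ∀ v → ∑[ u < n ] (if A v u then ind (critical u v) else 0) ≡ ind (inN₁ v)
  critical-arcs-at v =
    trans (sum-cong-≗ (λ u → if-ind (A v u) (critical u v))) (guarded (inN₁ v) refl)
    where
    guarded : ∀ c → inN₁ v ≡ c → ∑[ u < n ] ind ((mem S u ∧ c) ∧ A v u) ≡ ind c
    guarded false _ = trans (sum-cong-≗ (λ u → cong (λ b → ind (b ∧ A v u)) (∧-zeroʳ (mem S u))))
                            (sum-replicate-zero n)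
    guarded true  v∈N₁ = trans (sum-cong-≗ (λ u → cong (λ b → ind (b ∧ A v u)) (∧-identityʳ _)))
                               (unique-dominator v∈N₁)

module _ {n} (G : Graph n) (S : Subset n) where
  open Domination (adj G) S

  lost-at-edge : isDominating (adj G) S ≡ true → ∀ i j → lt i j ∧ adj G i j ≡ true →
    ind (not (isDominating (deleteEdge (adj G) (i , j)) S)) ≡ ind (critical j i) + ind (critical i j)
  lost-at-edge domS i j h =
    trans (cong (ind ∘ not) (edge-deletion (Graph.sym G) domS i≢j ij))
          (ind-lost (critical j i) (critical i j) (critical-exclusive j i))
    where
    ij : adj G i j ≡ true
    ij = ∧-conicalʳ _ _ h
    i≢j : i ≢ j
    i≢j refl with () ← trans (sym ij) (irrefl G i)

  dominating-set-count : isDominating (adj G) S ≡ true →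
    sum (map (λ e → ind (not (isDominating (deleteEdge (adj G) e) S))) (edges (adj G)))
      ≡ N₁size (adj G) S
  dominating-set-count domS = begin
    sum (map (λ e → ind (not (isDominating (deleteEdge (adj G) e) S))) (edges (adj G)))
      ≡⟨ sum-over-edges (adj G) _ ⟩
    ∑[ i < n ] ∑[ j < n ]
      (if lt i j ∧ adj G i j then ind (not (isDominating (deleteEdge (adj G) (i , j)) S)) else 0)
      ≡⟨ ∑∑-cong (λ i j → if-cong (lt i j ∧ adj G i j) (lost-at-edge domS i j)) ⟩
    ∑[ i < n ] ∑[ j < n ] (if lt i j ∧ adj G i j then ind (critical j i) + ind (critical i j) else 0)
      ≡⟨ ∑-unordered-pairs (adj G) (Graph.sym G) (irrefl G) (λ v u → ind (critical u v)) ⟩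
    ∑[ v < n ] ∑[ u < n ] (if adj G v u then ind (critical u v) else 0)
      ≡⟨ sum-cong-≗ critical-arcs-at ⟩
    ∑[ v < n ] ind (inN₁ v)
      ≡⟨ sym (count-allFin inN₁) ⟩
    N₁size (adj G) S ∎
    where open ≡-Reasoning

  subset-count : (if isDominating (adj G) S then N₁size (adj G) S else 0)
    ≡ sum (map (λ e → ind (isDominating (adj G) S ∧ not (isDominating (deleteEdge (adj G) e) S)))
               (edges (adj G)))
  subset-count with isDominating (adj G) S in domS
  ... | true  = sym (dominating-set-count domS)
  ... | false = sym (sum-map-zero (edges (adj G)))

lemma3p4 : ∀ {n : ℕ} (G : Graph n) →
    sum (map (N₁size (adj G)) (domSets (adj G)))
    ≡ sum (map (lostDomSets (adj G)) (edges (adj G)))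
lemma3p4 {n} G = begin
  sum (map (N₁size A) (domSets A))
    ≡⟨ sum-map-filterᵇ (isDominating A) (N₁size A) (allSubsets n) ⟩
  sum (map (λ S → if isDominating A S then N₁size A S else 0) (allSubsets n))
    ≡⟨ sum-map-cong (allSubsets n) (subset-count G) ⟩
  sum (map (λ S → sum (map (lost S) (edges A))) (allSubsets n))
    ≡⟨ sum-map-comm lost (allSubsets n) (edges A) ⟩
  sum (map (λ e → sum (map (λ S → lost S e) (allSubsets n))) (edges A))
    ≡⟨ sum-map-cong (edges A) (λ e → sym (length-filterᵇ _ (allSubsets n))) ⟩
  sum (map (lostDomSets A) (edges A)) ∎
  where
  open ≡-Reasoning
  A : Adj n
  A = adj G
  lost : Subset n → Fin n × Fin n → ℕ
  lost S e = ind (isDominating A S ∧ not (isDominating (deleteEdge A e) S))
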